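{- Let $q$ be a power of an odd prime $p$ and let $\ell$ be a linearized polynomial over $\mathbb F_{q^2}$. Suppose the function $x^{q+1}+\ell(x^2)$ is planar on $\mathbb F_{q^2}$. Then $\ell$ has at most $q$ roots in $\mathbb F_{q^2}$. Moreover, $\ell$ has exactly $q$ roots in $\mathbb F_{q^2}$ if $\ell(\mathbb F_{q^2})\cap\mathbb F_q=\{0\}$.
   Context: A linearized polynomial over $\mathbb F_{q^n}$ is a polynomial of the form $\sum_i b_i x^{p^i}$ with coefficients in $\mathbb F_{q^n}$. A function $f$ on $\mathbb F_{q^n}$ is planar if for every $c\in\mathbb F_{q^n}^*$ the map $x\mapsto f(x+c)-f(x)$ is a permutation of $\mathbb F_{q^n}$. -}

module Defs where

open import Level using (Level; _⊔_) renaming (suc to lsuc)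
open import Algebra.Bundles using (CommutativeRing)
open import Data.Nat using (ℕ; zero; suc; _^_)
open import Data.Fin using (Fin)
open import Data.List using (List; []; _∷_; length; filter; allFin)
open import Data.Product using (∃; _×_)
open import Relation.Nullary using (¬_)
open import Relation.Binary using (Decidable)
open import Relation.Binary.PropositionalEquality using (_≡_)

record FiniteField (c ℓ : Level) : Set (lsuc (c ⊔ ℓ)) where
  field
    commRing : CommutativeRing c ℓ
  open CommutativeRing commRing public
  field
    0≉1       : ¬ (0# ≈ 1#)
    inverse   : ∀ x → ¬ (x ≈ 0#) → ∃ λ y → x * y ≈ 1#
    _≟_       : Decidable _≈_
    size      : ℕ
    enum      : Fin size → Carrier
    enum-inj  : ∀ i j → enum i ≈ enum j → i ≡ j
    enum-surj : ∀ x → ∃ λ i → enum i ≈ x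

module _ {c ℓ : Level} (F : FiniteField c ℓ) where
  open FiniteField F

  pow : Carrier → ℕ → Carrier
  pow x zero    = 1#
  pow x (suc n) = x * pow x n

  -- Linearized polynomial with coefficient list b₀ ∷ b₁ ∷ … ∷ bₘ :
  --   ℓ(x) = Σᵢ bᵢ x^(p^i)
  linPolyFrom : (p : ℕ) → ℕ → List Carrier → Carrier → Carrier
  linPolyFrom p i []       x = 0#
  linPolyFrom p i (b ∷ bs) x = b * pow x (p ^ i) + linPolyFrom p (suc i) bs x

  linPoly : (p : ℕ) → List Carrier → Carrier → Carrier
  linPoly p bs = linPolyFrom p 0 bs

  numRoots : (Carrier → Carrier) → ℕ
  numRoots g = length (filter (λ i → g (enum i) ≟ 0#) (allFin size))

  Planar : (Carrier → Carrier) → Set (c ⊔ ℓ)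
  Planar f = ∀ a → ¬ (a ≈ 0#) →
    (∀ x y → f (x + a) - f x ≈ f (y + a) - f y → x ≈ y) ×
    (∀ z → ∃ λ x → f (x + a) - f x ≈ z)

  -- the subfield F_q of F_{q²}: fixed points of x ↦ x^q.
  -- ℓ(F_{q²}) ∩ F_q = {0}:
  ImageMeetsSubfieldTrivially : (q : ℕ) → (Carrier → Carrier) → Set (c ⊔ ℓ)
  ImageMeetsSubfieldTrivially q g = ∀ x → pow (g x) q ≈ g x → g x ≈ 0#

{-# OPTIONS --safe #-}
module Submission where

-- Since q² · 1 = 0 it has characteristic p,
-- hence x ↦ x ^ q is additive (Frobenius), and x ^ q² = x (Lagrange). The additive maps
-- φ x = x ^ q - x and ψ x = x ^ q + x have at most q roots each and φ maps into ker ψ, so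
-- rank–nullity for φ forces |ker φ| = |ker ψ| = q. Planarity of f x = x ^ (q + 1) + ℓ (x ^ 2)
-- at c = 1 makes x ↦ f (x + 1) - f x injective; this difference is ψ x + ℓ (2x) + 1 + ℓ 1,
-- so on ker ℓ ∩ ker ψ it takes its value at 0, whence ker ℓ ∩ ker ψ = 0 and |ker ℓ| · q ≤ q².
-- If moreover ℓ(𝔽) ∩ 𝔽_q = 0, then |ℓ(𝔽)| · q ≤ q², and rank–nullity for ℓ gives |ker ℓ| ≥ q.

open import Defs
open import Level using (Level; _⊔_)
open import Algebra.Bundles using (CommutativeRing; CommutativeMonoid)
open import Algebra.Solver.Ring.AlmostCommutativeRing using (fromCommutativeRing; _-Raw-AlmostCommutative⟶_)
import Algebra.Properties.CommutativeMonoid.Sum as CommutativeMonoidSum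
import Algebra.Properties.CommutativeSemiring.Binomial as Binomial
import Algebra.Properties.CommutativeSemiring.Exp as CommutativeSemiringExp
import Algebra.Properties.Ring as RingProperties
import Algebra.Properties.Semiring.Mult as SemiringMult
open import Data.Nat as ℕ using (ℕ; zero; suc; _≤_; _<_; z≤n; s≤s; NonZero; nonTrivial⇒n>1)
import Data.Nat.Properties as ℕ
open import Data.Nat.Combinatorics using (_C_; nCn≡1; nC1≡n; k>n⇒nCk≡0; nCk+nC[k+1]≡[n+1]C[k+1])
open import Data.Nat.Divisibility using (_∣_; divides; ∣⇒≤)
open import Data.Nat.Primality using (Prime; euclidsLemma; ¬prime[0]; prime⇒nonTrivial)
open import Data.Nat.Tactic.RingSolver using (solve-∀)
open import Data.Fin as Fin using (Fin; zero; suc; combine; remQuot; punchIn)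
import Data.Fin.Properties as Fin
import Data.Fin.Permutation as Permutation
open import Data.Integer as ℤ using (ℤ; +_; -[1+_])
import Data.Integer.Properties as ℤ
open import Data.Sign as Sign using (Sign)
open import Data.Maybe using (Maybe; just; nothing)
open import Data.Product using (∃; _×_; _,_; proj₁; proj₂)
open import Data.Product.Relation.Binary.Pointwise.NonDependent using (×-setoid)
open import Data.Sum using (_⊎_; inj₁; inj₂; [_,_]′; reduce)
open import Data.Empty using (⊥-elim)
open import Data.List using (List; []; _∷_; length; filter; allFin; lookup; replicate)
open import Data.List.Properties using (length-replicate)
import Data.List.Relation.Unary.All as All
open import Data.List.Relation.Unary.AllPairs using (_∷_)
open import Data.List.Relation.Unary.Unique.Propositional using (Unique)
import Data.List.Relation.Unary.Unique.Propositional.Properties as Unique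
open import Data.List.Membership.Propositional using (_∈_)
open import Data.List.Membership.Propositional.Properties using (∈-lookup; ∈-filter⁺; ∈-filter⁻; ∈-allFin)
import Data.List.Relation.Unary.Any as Any
import Data.List.Relation.Unary.Any.Properties as Any
open import Relation.Binary using (Setoid)
open import Relation.Binary.PropositionalEquality as ≡ using (_≡_; _≢_; cong; cong₂)
open import Relation.Nullary using (¬_; yes; no)
open import Relation.Unary using (Pred; Decidable; U; _⟨×⟩_)
open import Function using (_∘_; id)

module _ where
  open import Data.Nat using (_+_; _*_; _^_)

  [1+k]*[1+n]C[1+k]≡[1+n]*nCk : ∀ n k → suc k * (suc n C suc k) ≡ suc n * (n C k)
  [1+k]*[1+n]C[1+k]≡[1+n]*nCk zero zero = ≡.refl
  [1+k]*[1+n]C[1+k]≡[1+n]*nCk zero (suc k)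
    rewrite k>n⇒nCk≡0 {1} {suc (suc k)} (s≤s (s≤s z≤n)) | k>n⇒nCk≡0 {0} {suc k} (s≤s z≤n)
    = ℕ.*-zeroʳ (suc (suc k))
  [1+k]*[1+n]C[1+k]≡[1+n]*nCk (suc n) zero =
    ≡.trans (cong (1 *_) (nC1≡n (suc (suc n)))) (ℕ.*-comm 1 (suc (suc n)))
  [1+k]*[1+n]C[1+k]≡[1+n]*nCk (suc n) (suc k) = begin
    suc (suc k) * (suc (suc n) C suc (suc k))   ≡⟨ cong (suc (suc k) *_) (nCk+nC[k+1]≡[n+1]C[k+1] (suc n) (suc k)) ⟨
    suc (suc k) * (a + b)                       ≡⟨ regroupˡ k a b ⟩
    (suc k * a + a) + suc (suc k) * b           ≡⟨ cong₂ (λ u v → u + a + v) ([1+k]*[1+n]C[1+k]≡[1+n]*nCk n k)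
                                                                           ([1+k]*[1+n]C[1+k]≡[1+n]*nCk n (suc k)) ⟩
    suc n * (n C k) + a + suc n * (n C suc k)   ≡⟨ regroupʳ n (n C k) (n C suc k) a ⟩
    suc n * (n C k + n C suc k) + a             ≡⟨ cong (λ u → suc n * u + a) (nCk+nC[k+1]≡[n+1]C[k+1] n k) ⟩
    suc n * a + a                               ≡⟨ ℕ.+-comm (suc n * a) a ⟩
    suc (suc n) * a                             ∎
    where
    open ≡.≡-Reasoning
    a = suc n C suc k
    b = suc n C suc (suc k)
    regroupˡ : ∀ k a b → suc (suc k) * (a + b) ≡ (suc k * a + a) + suc (suc k) * b
    regroupˡ = solve-∀
    regroupʳ : ∀ n c d a → suc n * c + a + suc n * d ≡ suc n * (c + d) + a
    regroupʳ = solve-∀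

  prime⇒p∣pCk : ∀ {p k} → Prime p → 0 < k → k < p → p ∣ p C k
  prime⇒p∣pCk {suc n} {suc k} p-prime _ k<p
    with euclidsLemma (suc k) (suc n C suc k) p-prime
           (divides (n C k) (≡.trans ([1+k]*[1+n]C[1+k]≡[1+n]*nCk n k) (ℕ.*-comm (suc n) (n C k))))
  ... | inj₁ p∣1+k = ⊥-elim (ℕ.<⇒≱ k<p (∣⇒≤ p∣1+k))
  ... | inj₂ p∣pCk = p∣pCk

  2≤p^k : ∀ {p k} → Prime p → 1 ≤ k → 2 ≤ p ^ k
  2≤p^k {p} {suc k} p-prime _ = ℕ.≤-trans (nonTrivial⇒n>1 p) (ℕ.m≤m*n p (p ^ k))
    where instance
      p-nonTrivial = prime⇒nonTrivial p-prime
      p^k-nonZero  = ℕ.m^n≢0 p k {{ℕ.nonTrivial⇒nonZero p}}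

  o*o≤m*n⇒n≤o⇒o≤m : ∀ {m n o} .{{_ : NonZero o}} → o * o ≤ m * n → n ≤ o → o ≤ m
  o*o≤m*n⇒n≤o⇒o≤m {m} {n} {o} o*o≤m*n n≤o =
    ℕ.*-cancelʳ-≤ o m o (ℕ.≤-trans o*o≤m*n (ℕ.*-monoʳ-≤ m n≤o))

  m*n≤o*o⇒o≤n⇒m≤o : ∀ {m n o} .{{_ : NonZero o}} → m * n ≤ o * o → o ≤ n → m ≤ o
  m*n≤o*o⇒o≤n⇒m≤o {m} {n} {o} m*n≤o*o o≤n =
    ℕ.*-cancelʳ-≤ m o o (ℕ.≤-trans (ℕ.*-monoʳ-≤ m o≤n) m*n≤o*o)

record Enumeration {a r p} (S : Setoid a r) (P : Pred (Setoid.Carrier S) p) : Set (a ⊔ r ⊔ p) where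
  open Setoid S
  field
    card           : ℕ
    elem           : Fin card → Carrier
    elem∈          : ∀ i → P (elem i)
    elem-injective : ∀ i j → elem i ≈ elem j → i ≡ j
    index          : ∀ x → P x → Fin card
    elem-index     : ∀ x (px : P x) → elem (index x px) ≈ x

open Enumeration public

module _ {a b r s p q} {S : Setoid a r} {T : Setoid b s}
         {P : Pred (Setoid.Carrier S) p} {Q : Pred (Setoid.Carrier T) q} where
  private
    module S = Setoid S
    module T = Setoid T

  card-≤-injection : (EP : Enumeration S P) (EQ : Enumeration T Q) (h : S.Carrier → T.Carrier) →
                     (∀ {x} → P x → Q (h x)) → (∀ {x y} → P x → P y → h x T.≈ h y → x S.≈ y) →
                     card EP ≤ card EQ
  card-≤-injection EP EQ h h∈ h-injective = Fin.injective⇒≤ {f = f} f-injective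
    where
    f : Fin (card EP) → Fin (card EQ)
    f i = index EQ (h (elem EP i)) (h∈ (elem∈ EP i))
    f-injective : ∀ {i j} → f i ≡ f j → i ≡ j
    f-injective {i} {j} fi≡fj = elem-injective EP i j (h-injective (elem∈ EP i) (elem∈ EP j)
      (T.trans (T.sym (elem-index EQ _ (h∈ (elem∈ EP i))))
               (≡.subst (λ k → elem EQ k T.≈ h (elem EP j)) (≡.sym fi≡fj) (elem-index EQ _ (h∈ (elem∈ EP j))))))

  _⊗_ : Enumeration S P → Enumeration T Q → Enumeration (×-setoid S T) (P ⟨×⟩ Q)
  EP ⊗ EQ = record
    { card           = card EP ℕ.* card EQ
    ; elem           = λ k → elem EP (proj₁ (split k)) , elem EQ (proj₂ (split k))
    ; elem∈          = λ k → elem∈ EP _ , elem∈ EQ _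
    ; elem-injective = λ k l (eq₁ , eq₂) → split-injective k l (elem-injective EP _ _ eq₁) (elem-injective EQ _ _ eq₂)
    ; index          = λ (x , y) (px , qy) → combine (index EP x px) (index EQ y qy)
    ; elem-index     = λ (x , y) (px , qy) →
        ≡.subst (λ (i , j) → (elem EP i S.≈ x) × (elem EQ j T.≈ y))
                (≡.sym (Fin.remQuot-combine (index EP x px) (index EQ y qy)))
                (elem-index EP x px , elem-index EQ y qy)
    }
    where
    split : Fin (card EP ℕ.* card EQ) → Fin (card EP) × Fin (card EQ)
    split = remQuot {card EP} (card EQ)
    split-injective : ∀ k l → proj₁ (split k) ≡ proj₁ (split l) → proj₂ (split k) ≡ proj₂ (split l) → k ≡ l
    split-injective k l eq₁ eq₂ = ≡.trans (≡.sym (Fin.combine-remQuot {card EP} (card EQ) k))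
      (≡.trans (cong₂ combine eq₁ eq₂) (Fin.combine-remQuot {card EP} (card EQ) l))


module _ {c ℓ} (M : CommutativeMonoid c ℓ) where
  open CommutativeMonoid M
  open CommutativeMonoidSum M using (sum; sum-remove; sum-cong-≋; sum-replicate-zero)
  open import Relation.Binary.Reasoning.Setoid setoid

  sum-supported-at : ∀ {n} (f : Fin n → Carrier) i → (∀ j → j ≢ i → f j ≈ ε) → sum f ≈ f i
  sum-supported-at {suc n} f i f≈ε = begin
    sum f                          ≈⟨ sum-remove f ⟩
    f i ∙ sum (f ∘ punchIn i)      ≈⟨ ∙-congˡ (sum-cong-≋ (λ j → f≈ε (punchIn i j) (Fin.punchInᵢ≢i i j))) ⟩
    f i ∙ sum {n} (λ _ → ε)        ≈⟨ ∙-congˡ (sum-replicate-zero n) ⟩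
    f i ∙ ε                        ≈⟨ identityʳ (f i) ⟩
    f i                            ∎

-- Ring normalisation needs coefficients that compute, so a general commutative ring is
-- solved over ℤ (using the ring itself as coefficient ring gets stuck on an abstract carrier).
module IntegerCoefficientSolver {c ℓ} (R : CommutativeRing c ℓ) where
  open CommutativeRing R hiding (zero)
  open import Algebra.Properties.Semiring.Mult.TCOptimised semiring using (1+×; ×-homo-+; ×1-homo-*) renaming (_×_ to _·_)
  open RingProperties ring using (-‿+-comm; -‿involutive; -0#≈0#; -1*x≈-x)
  open import Relation.Binary.Reasoning.Setoid setoid

  ⟦_⟧ : ℤ → Carrier
  ⟦ + n ⟧      = n · 1#
  ⟦ -[1+ n ] ⟧ = - (suc n · 1#)

  private
    sign : Sign → Carrier
    sign Sign.+ = 1#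
    sign Sign.- = - 1#

    sign-homo : ∀ s t → sign (s Sign.* t) ≈ sign s * sign t
    sign-homo Sign.+ t      = sym (*-identityˡ _)
    sign-homo Sign.- Sign.+ = sym (*-identityʳ _)
    sign-homo Sign.- Sign.- = sym (trans (-1*x≈-x (- 1#)) (-‿involutive 1#))

    ◃-homo : ∀ s n → ⟦ s ℤ.◃ n ⟧ ≈ sign s * (n · 1#)
    ◃-homo s      zero    = sym (zeroʳ _)
    ◃-homo Sign.+ (suc n) = sym (*-identityˡ _)
    ◃-homo Sign.- (suc n) = sym (-1*x≈-x _)

    sign-abs : ∀ i → ⟦ i ⟧ ≈ sign (ℤ.sign i) * (ℤ.∣ i ∣ · 1#)
    sign-abs (+ n)      = sym (*-identityˡ _)
    sign-abs -[1+ n ]   = sym (-1*x≈-x _)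

    ⊖-homo : ∀ m n → ⟦ m ℤ.⊖ n ⟧ ≈ m · 1# - n · 1#
    ⊖-homo m       zero    = sym (trans (+-congˡ -0#≈0#) (+-identityʳ _))
    ⊖-homo zero    (suc n) = sym (+-identityˡ _)
    ⊖-homo (suc m) (suc n) rewrite ℤ.[1+m]⊖[1+n]≡m⊖n m n = begin
      ⟦ m ℤ.⊖ n ⟧                          ≈⟨ ⊖-homo m n ⟩
      m · 1# - n · 1#                      ≈⟨ +-identityˡ _ ⟨
      0# + (m · 1# - n · 1#)               ≈⟨ +-congʳ (-‿inverseʳ 1#) ⟨
      (1# - 1#) + (m · 1# - n · 1#)        ≈⟨ interchange ⟩
      (1# + m · 1#) - (1# + n · 1#)        ≈⟨ +-cong (1+× m 1#) (-‿cong (1+× n 1#)) ⟨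
      suc m · 1# - suc n · 1#              ∎
      where
      interchange : (1# - 1#) + (m · 1# - n · 1#) ≈ (1# + m · 1#) - (1# + n · 1#)
      interchange = begin
        (1# - 1#) + (m · 1# - n · 1#)          ≈⟨ +-assoc 1# (- 1#) _ ⟩
        1# + (- 1# + (m · 1# - n · 1#))        ≈⟨ +-congˡ (+-assoc (- 1#) _ _) ⟨
        1# + ((- 1# + m · 1#) - n · 1#)        ≈⟨ +-congˡ (+-congʳ (+-comm (- 1#) _)) ⟩
        1# + ((m · 1# - 1#) - n · 1#)          ≈⟨ +-congˡ (+-assoc _ (- 1#) _) ⟩
        1# + (m · 1# + (- 1# - n · 1#))        ≈⟨ +-assoc 1# _ _ ⟨
        (1# + m · 1#) + (- 1# - n · 1#)        ≈⟨ +-congˡ (-‿+-comm 1# _) ⟩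
        (1# + m · 1#) - (1# + n · 1#)          ∎

    +-homo : ∀ i j → ⟦ i ℤ.+ j ⟧ ≈ ⟦ i ⟧ + ⟦ j ⟧
    +-homo (+ m)    (+ n)    = ×-homo-+ 1# m n
    +-homo (+ m)    -[1+ n ] = ⊖-homo m (suc n)
    +-homo -[1+ m ] (+ n)    = trans (⊖-homo n (suc m)) (+-comm _ _)
    +-homo -[1+ m ] -[1+ n ] = begin
      - (suc (suc (m ℕ.+ n)) · 1#)          ≡⟨ cong (λ k → - (suc k · 1#)) (≡.sym (ℕ.+-suc m n)) ⟩
      - ((suc m ℕ.+ suc n) · 1#)            ≈⟨ -‿cong (×-homo-+ 1# (suc m) (suc n)) ⟩
      - (suc m · 1# + suc n · 1#)           ≈⟨ -‿+-comm _ _ ⟨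
      - (suc m · 1#) + - (suc n · 1#)       ∎

    *-homo : ∀ i j → ⟦ i ℤ.* j ⟧ ≈ ⟦ i ⟧ * ⟦ j ⟧
    *-homo i j = begin
      ⟦ (ℤ.sign i Sign.* ℤ.sign j) ℤ.◃ (ℤ.∣ i ∣ ℕ.* ℤ.∣ j ∣) ⟧
        ≈⟨ ◃-homo (ℤ.sign i Sign.* ℤ.sign j) (ℤ.∣ i ∣ ℕ.* ℤ.∣ j ∣) ⟩
      sign (ℤ.sign i Sign.* ℤ.sign j) * ((ℤ.∣ i ∣ ℕ.* ℤ.∣ j ∣) · 1#)
        ≈⟨ *-cong (sign-homo (ℤ.sign i) (ℤ.sign j)) (×1-homo-* ℤ.∣ i ∣ ℤ.∣ j ∣) ⟩
      (sign (ℤ.sign i) * sign (ℤ.sign j)) * ((ℤ.∣ i ∣ · 1#) * (ℤ.∣ j ∣ · 1#))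
        ≈⟨ interchange _ _ _ _ ⟩
      (sign (ℤ.sign i) * (ℤ.∣ i ∣ · 1#)) * (sign (ℤ.sign j) * (ℤ.∣ j ∣ · 1#))
        ≈⟨ *-cong (sign-abs i) (sign-abs j) ⟨
      ⟦ i ⟧ * ⟦ j ⟧ ∎
      where
      interchange : ∀ a b c d → (a * b) * (c * d) ≈ (a * c) * (b * d)
      interchange a b c d = begin
        (a * b) * (c * d)  ≈⟨ *-assoc a b _ ⟩
        a * (b * (c * d))  ≈⟨ *-congˡ (*-assoc b c d) ⟨
        a * ((b * c) * d)  ≈⟨ *-congˡ (*-congʳ (*-comm b c)) ⟩
        a * ((c * b) * d)  ≈⟨ *-congˡ (*-assoc c b d) ⟩
        a * (c * (b * d))  ≈⟨ *-assoc a c _ ⟨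
        (a * c) * (b * d)  ∎

    -‿homo : ∀ i → ⟦ ℤ.- i ⟧ ≈ - ⟦ i ⟧
    -‿homo -[1+ n ]    = sym (-‿involutive _)
    -‿homo (+ zero)    = sym -0#≈0#
    -‿homo (+ suc n)   = refl

    homomorphism : ℤ.+-*-rawRing -Raw-AlmostCommutative⟶ fromCommutativeRing R
    homomorphism = record
      { ⟦_⟧ = ⟦_⟧ ; +-homo = +-homo ; *-homo = *-homo ; -‿homo = -‿homo
      ; 0-homo = refl ; 1-homo = refl }

    ⟦⟧-equal? : ∀ i j → Maybe (⟦ i ⟧ ≈ ⟦ j ⟧)
    ⟦⟧-equal? i j with i ℤ.≟ j
    ... | yes ≡.refl = just refl
    ... | no  _      = nothing

  open import Algebra.Solver.Ring ℤ.+-*-rawRing (fromCommutativeRing R) homomorphism ⟦⟧-equal? public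
    using (solve; _:=_; _:+_; _:*_; _:-_; con)

module CharacteristicRing {c ℓ} (R : CommutativeRing c ℓ) where
  open CommutativeRing R hiding (zero)
  open SemiringMult semiring using (×-assoc-*; ×1-homo-*; ×-congʳ) renaming (_×_ to _·_)
  open CommutativeSemiringExp commutativeSemiring using (_^_; ^-congˡ; ^-assocʳ)
  private module Σ = CommutativeMonoidSum +-commutativeMonoid
  open import Relation.Binary.Reasoning.Setoid setoid

  ×1-homo-^ : ∀ n k → (n ℕ.^ k) · 1# ≈ (n · 1#) ^ k
  ×1-homo-^ n zero    = +-identityʳ 1#
  ×1-homo-^ n (suc k) = trans (×1-homo-* n (n ℕ.^ k)) (*-congˡ (×1-homo-^ n k))

  p∣n⇒n·x≈0 : ∀ {p n} → p · 1# ≈ 0# → p ∣ n → ∀ x → n · x ≈ 0#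
  p∣n⇒n·x≈0 {p} char-p (divides d ≡.refl) x = begin
    (d ℕ.* p) · x             ≈⟨ ×-congʳ (d ℕ.* p) (*-identityˡ x) ⟨
    (d ℕ.* p) · (1# * x)      ≈⟨ ×-assoc-* (d ℕ.* p) 1# x ⟨
    ((d ℕ.* p) · 1#) * x      ≈⟨ *-congʳ (×1-homo-* d p) ⟩
    (d · 1#) * (p · 1#) * x   ≈⟨ *-congʳ (*-congˡ char-p) ⟩
    (d · 1#) * 0# * x         ≈⟨ *-congʳ (zeroʳ _) ⟩
    0# * x                    ≈⟨ zeroˡ x ⟩
    0#                        ∎

  frobenius : ∀ {p} → Prime p → p · 1# ≈ 0# → ∀ x y → (x + y) ^ p ≈ x ^ p + y ^ p
  frobenius {zero}  p-prime = ⊥-elim (¬prime[0] p-prime)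
  frobenius {suc m} p-prime char-p x y = begin
    (x + y) ^ p                                              ≈⟨ Binomial.theorem commutativeSemiring p x y ⟩
    t zero + Σ.sum (λ i → t (suc i))                         ≈⟨ +-congˡ (Σ.sum-init-last (λ i → t (suc i))) ⟩
    t zero + (Σ.sum (λ i → t (suc (Fin.inject₁ i))) + t (suc (Fin.fromℕ m)))
      ≈⟨ +-cong first (+-cong (trans (Σ.sum-cong-≋ middle) (Σ.sum-replicate-zero m)) (last (Fin.toℕ-fromℕ m))) ⟩
    y ^ p + (0# + x ^ p)                                     ≈⟨ +-congˡ (+-identityˡ (x ^ p)) ⟩
    y ^ p + x ^ p                                            ≈⟨ +-comm (y ^ p) (x ^ p) ⟩
    x ^ p + y ^ p                                            ∎
    where
    p = suc m
    t = Binomial.binomialTerm commutativeSemiring x y p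
    first : t zero ≈ y ^ p
    first = trans (+-identityʳ _) (*-identityˡ _)
    middle : ∀ i → t (suc (Fin.inject₁ i)) ≈ 0#
    middle i = p∣n⇒n·x≈0 char-p (prime⇒p∣pCk p-prime (s≤s z≤n)
      (s≤s (≡.subst (_< m) (≡.sym (Fin.toℕ-inject₁ i)) (Fin.toℕ<n i)))) _
    last : ∀ {j} → j ≡ m → (p C suc j) · (x ^ suc j * y ^ (m ℕ.∸ j)) ≈ x ^ p
    last ≡.refl rewrite nCn≡1 p | ℕ.n∸n≡0 m = trans (+-identityʳ _) (*-identityʳ _)

  frobenius-^ : ∀ {p} → Prime p → p · 1# ≈ 0# → ∀ i x y → (x + y) ^ (p ℕ.^ i) ≈ x ^ (p ℕ.^ i) + y ^ (p ℕ.^ i)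
  frobenius-^ p-prime char-p zero x y = distribʳ 1# x y
  frobenius-^ {p} p-prime char-p (suc i) x y = begin
    (x + y) ^ (p ℕ.* p ℕ.^ i)                  ≈⟨ ^-assocʳ (x + y) p (p ℕ.^ i) ⟨
    ((x + y) ^ p) ^ (p ℕ.^ i)                  ≈⟨ ^-congˡ (p ℕ.^ i) (frobenius p-prime char-p x y) ⟩
    (x ^ p + y ^ p) ^ (p ℕ.^ i)                ≈⟨ frobenius-^ p-prime char-p i (x ^ p) (y ^ p) ⟩
    (x ^ p) ^ (p ℕ.^ i) + (y ^ p) ^ (p ℕ.^ i)  ≈⟨ +-cong (^-assocʳ x p (p ℕ.^ i)) (^-assocʳ y p (p ℕ.^ i)) ⟩
    x ^ (p ℕ.* p ℕ.^ i) + y ^ (p ℕ.* p ℕ.^ i)  ∎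

module FiniteFieldTheory {c ℓ} (F : FiniteField c ℓ) where
  open FiniteField F hiding (zero)
  open CharacteristicRing commRing using (×1-homo-^)
  open SemiringMult semiring using (×1-homo-*) renaming (_×_ to _·_)
  open CommutativeSemiringExp commutativeSemiring using (_^_; ^-congˡ)
  open RingProperties ring using (-0#≈0#; x∙y⁻¹≈ε⇒x≈y; x+x≈x⇒x≈0; +-inverseˡ-unique; +-cancelˡ)
  open IntegerCoefficientSolver commRing using (solve; _:=_; _:+_; _:*_; _:-_; con)
  private
    module Σ = CommutativeMonoidSum +-commutativeMonoid
    module Π = CommutativeMonoidSum *-commutativeMonoid
  open import Relation.Binary.Reasoning.Setoid setoid

  1≉0 : ¬ 1# ≈ 0#
  1≉0 1≈0 = 0≉1 (sym 1≈0)

  x*y≈0⇒x≈0⊎y≈0 : ∀ {x y} → x * y ≈ 0# → x ≈ 0# ⊎ y ≈ 0#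
  x*y≈0⇒x≈0⊎y≈0 {x} {y} xy≈0 with x ≟ 0#
  ... | yes x≈0 = inj₁ x≈0
  ... | no  x≉0 with inverse x x≉0
  ... | x⁻¹ , x*x⁻¹≈1 = inj₂ (begin
    y              ≈⟨ *-identityˡ y ⟨
    1# * y         ≈⟨ *-congʳ x*x⁻¹≈1 ⟨
    (x * x⁻¹) * y  ≈⟨ solve 3 (λ x x⁻¹ y → (x :* x⁻¹) :* y := x⁻¹ :* (x :* y)) refl x x⁻¹ y ⟩
    x⁻¹ * (x * y)  ≈⟨ *-congˡ xy≈0 ⟩
    x⁻¹ * 0#       ≈⟨ zeroʳ x⁻¹ ⟩
    0#             ∎)

  x≉0⇒y≉0⇒x*y≉0 : ∀ {x y} → ¬ x ≈ 0# → ¬ y ≈ 0# → ¬ x * y ≈ 0#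
  x≉0⇒y≉0⇒x*y≉0 x≉0 y≉0 = [ x≉0 , y≉0 ]′ ∘ x*y≈0⇒x≈0⊎y≈0

  x^n≈0⇒x≈0 : ∀ n {x} → x ^ n ≈ 0# → x ≈ 0#
  x^n≈0⇒x≈0 zero    1≈0 = ⊥-elim (1≉0 1≈0)
  x^n≈0⇒x≈0 (suc n) = [ id , x^n≈0⇒x≈0 n ]′ ∘ x*y≈0⇒x≈0⊎y≈0

  x-y≈0⇒x≈y : ∀ {x y} → x - y ≈ 0# → x ≈ y
  x-y≈0⇒x≈y = x∙y⁻¹≈ε⇒x≈y _ _

  pow≡^ : ∀ x n → pow F x n ≡ x ^ n
  pow≡^ x zero    = ≡.refl
  pow≡^ x (suc n) = cong (x *_) (pow≡^ x n)

  pow-cong : ∀ n {x y} → x ≈ y → pow F x n ≈ pow F y n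
  pow-cong zero    x≈y = refl
  pow-cong (suc n) x≈y = *-cong x≈y (pow-cong n x≈y)

  ∑ : (Carrier → Carrier) → Carrier
  ∑ f = Σ.sum (λ i → f (enum i))

  ∏ : (Carrier → Carrier) → Carrier
  ∏ f = Π.sum (λ i → f (enum i))

  module _ (u v : Carrier → Carrier) (u-cong : ∀ {x y} → x ≈ y → u x ≈ u y) (v-cong : ∀ {x y} → x ≈ y → v x ≈ v y)
           (u∘v≈id : ∀ x → u (v x) ≈ x) (v∘u≈id : ∀ x → v (u x) ≈ x) where
    private
      along : (Carrier → Carrier) → Fin size → Fin size
      along w i = proj₁ (enum-surj (w (enum i)))
      reindexing : Permutation.Permutation size size
      reindexing = Permutation.permutation (along u) (along v)
        (λ i → enum-inj _ _ (trans (proj₂ (enum-surj _)) (trans (u-cong (proj₂ (enum-surj _))) (u∘v≈id (enum i)))))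
        (λ i → enum-inj _ _ (trans (proj₂ (enum-surj _)) (trans (v-cong (proj₂ (enum-surj _))) (v∘u≈id (enum i)))))
      reindexing-correct : ∀ i → enum (reindexing Permutation.⟨$⟩ʳ i) ≈ u (enum i)
      reindexing-correct i = proj₂ (enum-surj (u (enum i)))

    ∑-reindex : ∀ f → (∀ {x y} → x ≈ y → f x ≈ f y) → ∑ f ≈ ∑ (f ∘ u)
    ∑-reindex f f-cong = trans (Σ.sum-permute _ reindexing) (Σ.sum-cong-≋ (f-cong ∘ reindexing-correct))

    ∏-reindex : ∀ f → (∀ {x y} → x ≈ y → f x ≈ f y) → ∏ f ≈ ∏ (f ∘ u)
    ∏-reindex f f-cong = trans (Π.sum-permute _ reindexing) (Π.sum-cong-≋ (f-cong ∘ reindexing-correct))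

  size·x≈0 : ∀ x → size · x ≈ 0#
  size·x≈0 x = +-cancelˡ (∑ id) (size · x) 0# (begin
    ∑ id + size · x         ≈⟨ +-congˡ (Σ.sum-replicate size) ⟨
    ∑ id + ∑ (λ _ → x)      ≈⟨ Σ.∑-distrib-+ enum (λ _ → x) ⟨
    ∑ (_+ x)                ≈⟨ ∑-reindex (_+ x) (_- x) +-congʳ +-congʳ
                                 (λ y → solve 2 (λ y x → (y :- x) :+ x := y) refl y x)
                                 (λ y → solve 2 (λ y x → (y :+ x) :- x := y) refl y x) id id ⟨
    ∑ id                    ≈⟨ +-identityʳ (∑ id) ⟨
    ∑ id + 0#               ∎)

  characteristic : ∀ {p k} → size ≡ p ℕ.^ k ℕ.* p ℕ.^ k → p · 1# ≈ 0#
  characteristic {p} {k} size≡q*q = x^n≈0⇒x≈0 k (trans (sym (×1-homo-^ p k)) q·1≈0)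
    where
    q = p ℕ.^ k
    q·1≈0 : q · 1# ≈ 0#
    q·1≈0 = reduce (x*y≈0⇒x≈0⊎y≈0 (trans (sym (×1-homo-* q q)) (≡.subst (λ n → n · 1# ≈ 0#) size≡q*q (size·x≈0 1#))))

  zeroToOne : Carrier → Carrier
  zeroToOne x with x ≟ 0#
  ... | yes _ = 1#
  ... | no  _ = x

  atZeroElseOne : Carrier → Carrier → Carrier
  atZeroElseOne a x with x ≟ 0#
  ... | yes _ = a
  ... | no  _ = 1#

  zeroToOne-cong : ∀ {x y} → x ≈ y → zeroToOne x ≈ zeroToOne y
  zeroToOne-cong {x} {y} x≈y with x ≟ 0# | y ≟ 0#
  ... | yes _   | yes _   = refl
  ... | no  _   | no  _   = x≈y
  ... | yes x≈0 | no  y≉0 = ⊥-elim (y≉0 (trans (sym x≈y) x≈0))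
  ... | no  x≉0 | yes y≈0 = ⊥-elim (x≉0 (trans x≈y y≈0))

  zeroToOne≉0 : ∀ x → ¬ zeroToOne x ≈ 0#
  zeroToOne≉0 x with x ≟ 0#
  ... | yes _   = 1≉0
  ... | no  x≉0 = x≉0

  *-zeroToOne : ∀ {a} → ¬ a ≈ 0# → ∀ x → a * zeroToOne x ≈ zeroToOne (a * x) * atZeroElseOne a x
  *-zeroToOne {a} a≉0 x with x ≟ 0# | (a * x) ≟ 0#
  ... | yes _   | yes _    = trans (*-identityʳ a) (sym (*-identityˡ a))
  ... | yes x≈0 | no  ax≉0 = ⊥-elim (ax≉0 (trans (*-congˡ x≈0) (zeroʳ a)))
  ... | no  x≉0 | yes ax≈0 = ⊥-elim (x≉0⇒y≉0⇒x*y≉0 a≉0 x≉0 ax≈0)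
  ... | no  _   | no  _    = sym (*-identityʳ _)

  ∏-atZeroElseOne : ∀ a → ∏ (atZeroElseOne a) ≈ a
  ∏-atZeroElseOne a = begin
    ∏ (atZeroElseOne a)        ≈⟨ sum-supported-at *-commutativeMonoid _ i₀ at-nonzero ⟩
    atZeroElseOne a (enum i₀)  ≈⟨ at-zero ⟩
    a                          ∎
    where
    i₀ = proj₁ (enum-surj 0#)
    at-zero : atZeroElseOne a (enum i₀) ≈ a
    at-zero with enum i₀ ≟ 0#
    ... | yes _  = refl
    ... | no  ≉0 = ⊥-elim (≉0 (proj₂ (enum-surj 0#)))
    at-nonzero : ∀ i → i ≢ i₀ → atZeroElseOne a (enum i) ≈ 1#
    at-nonzero i i≢i₀ with enum i ≟ 0#
    ... | yes ≈0 = ⊥-elim (i≢i₀ (enum-inj i i₀ (trans ≈0 (sym (proj₂ (enum-surj 0#))))))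
    ... | no  _  = refl

  1^n≈1 : ∀ n → 1# ^ n ≈ 1#
  1^n≈1 zero    = refl
  1^n≈1 (suc n) = trans (*-identityˡ _) (1^n≈1 n)

  *-cancelʳ-nonzero : ∀ {x y z} → ¬ z ≈ 0# → x * z ≈ y * z → x ≈ y
  *-cancelʳ-nonzero {x} {y} {z} z≉0 xz≈yz = [ x-y≈0⇒x≈y , ⊥-elim ∘ z≉0 ]′ (x*y≈0⇒x≈0⊎y≈0 (begin
    (x - y) * z      ≈⟨ solve 3 (λ x y z → (x :- y) :* z := x :* z :- y :* z) refl x y z ⟩
    x * z - y * z    ≈⟨ +-congʳ xz≈yz ⟩
    y * z - y * z    ≈⟨ -‿inverseʳ (y * z) ⟩
    0#               ∎))

  product-nonzero : ∀ {n} (f : Fin n → Carrier) → (∀ i → ¬ f i ≈ 0#) → ¬ Π.sum f ≈ 0#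
  product-nonzero {zero}  f f≉0 = 1≉0
  product-nonzero {suc n} f f≉0 = x≉0⇒y≉0⇒x*y≉0 (f≉0 zero) (product-nonzero (f ∘ suc) (f≉0 ∘ suc))

  -- Lagrange's argument: compare products over the field before and after scaling by x,
  -- with 0 replaced by 1 so that the product stays invertible.
  x≉0⇒x^size≈x : ∀ {x} → ¬ x ≈ 0# → x ^ size ≈ x
  x≉0⇒x^size≈x {x} x≉0 with inverse x x≉0
  ... | x⁻¹ , x*x⁻¹≈1 = *-cancelʳ-nonzero N≉0 (begin
    x ^ size * N                                     ≈⟨ *-congʳ (Π.sum-replicate size) ⟨
    ∏ (λ _ → x) * N                                  ≈⟨ Π.∑-distrib-+ (λ _ → x) (zeroToOne ∘ enum) ⟨
    ∏ (λ y → x * zeroToOne y)                        ≈⟨ Π.sum-cong-≋ (*-zeroToOne x≉0 ∘ enum) ⟩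
    ∏ (λ y → zeroToOne (x * y) * atZeroElseOne x y)  ≈⟨ Π.∑-distrib-+ (zeroToOne ∘ (x *_) ∘ enum) (atZeroElseOne x ∘ enum) ⟩
    ∏ (zeroToOne ∘ (x *_)) * ∏ (atZeroElseOne x)     ≈⟨ *-cong scaling-permutes (sym (∏-atZeroElseOne x)) ⟨
    N * x                                            ≈⟨ *-comm N x ⟩
    x * N                                            ∎)
    where
    N = ∏ zeroToOne
    N≉0 : ¬ N ≈ 0#
    N≉0 = product-nonzero (zeroToOne ∘ enum) (zeroToOne≉0 ∘ enum)
    x*x⁻¹* : ∀ y → x * (x⁻¹ * y) ≈ y
    x*x⁻¹* y = trans (sym (*-assoc x x⁻¹ y)) (trans (*-congʳ x*x⁻¹≈1) (*-identityˡ y))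
    x⁻¹*x* : ∀ y → x⁻¹ * (x * y) ≈ y
    x⁻¹*x* y = trans (sym (*-assoc x⁻¹ x y)) (trans (*-congʳ (trans (*-comm x⁻¹ x) x*x⁻¹≈1)) (*-identityˡ y))
    scaling-permutes : N ≈ ∏ (zeroToOne ∘ (x *_))
    scaling-permutes = ∏-reindex (x *_) (x⁻¹ *_) *-congˡ *-congˡ x*x⁻¹* x⁻¹*x* zeroToOne zeroToOne-cong

  x^size≈x : ∀ x → x ^ size ≈ x
  x^size≈x x with x ≟ 0#
  ... | no  x≉0 = x≉0⇒x^size≈x x≉0
  ... | yes x≈0 = trans (^-congˡ size x≈0) (trans (0^n≈0 (proj₁ (enum-surj x))) (sym x≈0))
    where
    0^n≈0 : ∀ {n} → Fin n → 0# ^ n ≈ 0#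
    0^n≈0 {suc n} _ = zeroˡ _

  filterEnumeration : ∀ {p} (P : Pred Carrier p) → Decidable P → (∀ {x y} → x ≈ y → P x → P y) → Enumeration setoid P
  filterEnumeration P P? P-resp = record
    { card           = length selected
    ; elem           = λ i → enum (lookup selected i)
    ; elem∈          = λ i → proj₂ (∈-filter⁻ (P? ∘ enum) {xs = allFin size} (∈-lookup {xs = selected} i))
    ; elem-injective = λ i j eq → lookup-injective (Unique.filter⁺ (P? ∘ enum) (Unique.allFin⁺ size)) (enum-inj _ _ eq)
    ; index          = λ x px → Any.index (index∈selected x px)
    ; elem-index     = λ x px → ≡.subst (λ i → enum i ≈ x) (Any.lookup-index (index∈selected x px)) (proj₂ (enum-surj x))
    }
    where
    selected : List (Fin size)
    selected = filter (P? ∘ enum) (allFin size)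
    index∈selected : ∀ x → P x → proj₁ (enum-surj x) ∈ selected
    index∈selected x px = ∈-filter⁺ (P? ∘ enum) (∈-allFin _) (P-resp (sym (proj₂ (enum-surj x))) px)
    lookup-injective : ∀ {xs : List (Fin size)} → Unique xs → ∀ {i j} → lookup xs i ≡ lookup xs j → i ≡ j
    lookup-injective (_   ∷ _)  {zero}  {zero}  _  = ≡.refl
    lookup-injective (x∉ ∷ _)  {zero}  {suc j} eq = ⊥-elim (All.lookup x∉ (∈-lookup j) eq)
    lookup-injective (x∉ ∷ _)  {suc i} {zero}  eq = ⊥-elim (All.lookup x∉ (∈-lookup i) (≡.sym eq))
    lookup-injective (_   ∷ u)  {suc i} {suc j} eq = cong suc (lookup-injective u eq)

  elements : Enumeration setoid U
  elements = record
    { card = size ; elem = enum ; elem∈ = _ ; elem-injective = enum-inj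
    ; index = λ x _ → proj₁ (enum-surj x) ; elem-index = λ x _ → proj₂ (enum-surj x) }

  record AdditiveSubgroup : Set (c ⊔ Level.suc ℓ) where
    field
      Member      : Pred Carrier ℓ
      member-resp : ∀ {x y} → x ≈ y → Member x → Member y
      member-sub  : ∀ {x y} → Member x → Member y → Member (x - y)
      members     : Enumeration setoid Member

  open AdditiveSubgroup

  order : AdditiveSubgroup → ℕ
  order G = card (members G)

  order-mono : ∀ G H → (∀ {x} → Member G x → Member H x) → order G ≤ order H
  order-mono G H G⊆H = card-≤-injection (members G) (members H) id G⊆H (λ _ _ x≈y → x≈y)

  order*order≤size : ∀ G H → (∀ {x} → Member G x → Member H x → x ≈ 0#) → order G ℕ.* order H ≤ size
  order*order≤size G H G∩H≈0 = card-≤-injection (members G ⊗ members H) elements (λ (x , y) → x - y) _ injective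
    where
    injective : ∀ {u v} → (Member G ⟨×⟩ Member H) u → (Member G ⟨×⟩ Member H) v →
                proj₁ u - proj₂ u ≈ proj₁ v - proj₂ v → (proj₁ u ≈ proj₁ v) × (proj₂ u ≈ proj₂ v)
    injective {x , y} {x′ , y′} (gx , hy) (gx′ , hy′) x-y≈x′-y′ = x-y≈0⇒x≈y x-x′≈0 , x-y≈0⇒x≈y y-y′≈0
      where
      x-x′≈y-y′ : x - x′ ≈ y - y′
      x-x′≈y-y′ = begin
        x - x′                           ≈⟨ solve 4 (λ x x′ y y′ → x :- x′ := ((x :- y) :- (x′ :- y′)) :+ (y :- y′)) refl x x′ y y′ ⟩
        ((x - y) - (x′ - y′)) + (y - y′) ≈⟨ +-congʳ (trans (+-congʳ x-y≈x′-y′) (-‿inverseʳ _)) ⟩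
        0# + (y - y′)                    ≈⟨ +-identityˡ _ ⟩
        y - y′                           ∎
      x-x′≈0 : x - x′ ≈ 0#
      x-x′≈0 = G∩H≈0 (member-sub G gx gx′) (member-resp H (sym x-x′≈y-y′) (member-sub H hy hy′))
      y-y′≈0 : y - y′ ≈ 0#
      y-y′≈0 = trans (sym x-x′≈y-y′) x-x′≈0

  module AdditiveMap (g : Carrier → Carrier) (g-cong : ∀ {x y} → x ≈ y → g x ≈ g y)
                     (g-+ : ∀ x y → g (x + y) ≈ g x + g y) where

    g-0 : g 0# ≈ 0#
    g-0 = x+x≈x⇒x≈0 (g 0#) (trans (sym (g-+ 0# 0#)) (g-cong (+-identityˡ 0#)))

    g-sub : ∀ x y → g (x - y) ≈ g x - g y
    g-sub x y = trans (g-+ x (- y)) (+-congˡ g-neg)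
      where
      g-neg : g (- y) ≈ - g y
      g-neg = +-inverseˡ-unique (g (- y)) (g y) (trans (sym (g-+ (- y) y)) (trans (g-cong (-‿inverseˡ y)) g-0))

    kernel : AdditiveSubgroup
    kernel = record
      { Member      = λ x → g x ≈ 0#
      ; member-resp = λ x≈y gx≈0 → trans (g-cong (sym x≈y)) gx≈0
      ; member-sub  = λ {x} {y} gx≈0 gy≈0 →
          trans (g-sub x y) (trans (+-cong gx≈0 (-‿cong gy≈0)) (trans (+-congˡ -0#≈0#) (+-identityʳ 0#)))
      ; members     = filterEnumeration _ (λ x → g x ≟ 0#) (λ x≈y gx≈0 → trans (g-cong (sym x≈y)) gx≈0)
      }

    InImage : Pred Carrier ℓ
    InImage y = ∃ λ (i : Fin size) → g (enum i) ≈ y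

    image : AdditiveSubgroup
    image = record
      { Member      = InImage
      ; member-resp = λ x≈y (i , gi≈x) → i , trans gi≈x x≈y
      ; member-sub  = λ (i , gi≈x) (j , gj≈y) → proj₁ (enum-surj (enum i - enum j)) ,
          trans (g-cong (proj₂ (enum-surj _))) (trans (g-sub (enum i) (enum j)) (+-cong gi≈x (-‿cong gj≈y)))
      ; members     = filterEnumeration InImage (λ y → Fin.any? (λ i → g (enum i) ≟ y)) (λ x≈y (i , gi≈x) → i , trans gi≈x x≈y)
      }

    -- With a section s of g over its image, x ↦ (x - s (g x) , g x) embeds the field into kernel × image.
    size≤order-kernel*order-image : size ≤ order kernel ℕ.* order image
    size≤order-kernel*order-image = card-≤-injection elements (members kernel ⊗ members image)
      (λ x → x - section x , g x) (λ {x} _ → g[x-section]≈0 x , gx∈image x) injective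
      where
      gx∈image : ∀ x → InImage (g x)
      gx∈image x = proj₁ (enum-surj x) , g-cong (proj₂ (enum-surj x))
      index-gx : Carrier → Fin (order image)
      index-gx x = index (members image) (g x) (gx∈image x)
      section : Carrier → Carrier
      section x = enum (proj₁ (elem∈ (members image) (index-gx x)))
      g∘section : ∀ x → g (section x) ≈ g x
      g∘section x = trans (proj₂ (elem∈ (members image) (index-gx x))) (elem-index (members image) (g x) (gx∈image x))
      g[x-section]≈0 : ∀ x → g (x - section x) ≈ 0#
      g[x-section]≈0 x = trans (g-sub x (section x)) (trans (+-congˡ (-‿cong (g∘section x))) (-‿inverseʳ (g x)))
      injective : ∀ {x y} → U x → U y → ((x - section x) ≈ (y - section y)) × (g x ≈ g y) → x ≈ y
      injective {x} {y} _ _ (x-sx≈y-sy , gx≈gy) = begin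
        x                            ≈⟨ solve 2 (λ x s → x := (x :- s) :+ s) refl x (section x) ⟩
        (x - section x) + section x  ≈⟨ +-cong x-sx≈y-sy (reflexive (cong (λ i → enum (proj₁ (elem∈ (members image) i))) same-index)) ⟩
        (y - section y) + section y  ≈⟨ solve 2 (λ x s → (x :- s) :+ s := x) refl y (section y) ⟩
        y                            ∎
        where
        same-index : index-gx x ≡ index-gx y
        same-index = elem-injective (members image) _ _
          (trans (elem-index (members image) (g x) (gx∈image x)) (trans gx≈gy (sym (elem-index (members image) (g y) (gx∈image y)))))

  -- c₀ ∷ c₁ ∷ … ∷ cₙ₋₁ stands for the monic polynomial xⁿ + cₙ₋₁xⁿ⁻¹ + … + c₀.
  monic : List Carrier → Carrier → Carrier
  monic []       x = 1#
  monic (c ∷ cs) x = c + x * monic cs x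

  quotient : List Carrier → Carrier → List Carrier
  quotient []           a = []
  quotient (c ∷ [])     a = []
  quotient (c ∷ d ∷ cs) a = monic (d ∷ cs) a ∷ quotient (d ∷ cs) a

  length-quotient : ∀ c cs a → length (quotient (c ∷ cs) a) ≡ length cs
  length-quotient c []       a = ≡.refl
  length-quotient c (d ∷ cs) a = cong suc (length-quotient d cs a)

  division : ∀ c cs a x → monic (c ∷ cs) x ≈ (x - a) * monic (quotient (c ∷ cs) a) x + monic (c ∷ cs) a
  division c [] a x =
    solve 3 (λ c a x → c :+ x :* con (+ 1) := (x :- a) :* con (+ 1) :+ (c :+ a :* con (+ 1))) refl c a x
  division c (d ∷ cs) a x = begin
    c + x * monic (d ∷ cs) x      ≈⟨ +-congˡ (*-congˡ (division d cs a x)) ⟩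
    c + x * ((x - a) * Q + r)     ≈⟨ solve 5 (λ c x a Q r → c :+ x :* ((x :- a) :* Q :+ r) := (x :- a) :* (r :+ x :* Q) :+ (c :+ a :* r))
                                           refl c x a Q r ⟩
    (x - a) * (r + x * Q) + (c + a * r) ∎
    where
    Q = monic (quotient (d ∷ cs) a) x
    r = monic (d ∷ cs) a

  roots≤degree : ∀ cs {m} (root : Fin m → Carrier) → (∀ i j → root i ≈ root j → i ≡ j) →
                 (∀ i → monic cs (root i) ≈ 0#) → m ≤ length cs
  roots≤degree cs       {zero}  root injective isRoot = z≤n
  roots≤degree []       {suc m} root injective isRoot = ⊥-elim (1≉0 (isRoot zero))
  roots≤degree (c ∷ cs) {suc m} root injective isRoot =
    s≤s (≡.subst (m ≤_) (length-quotient c cs a)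
      (roots≤degree (quotient (c ∷ cs) a) (root ∘ suc) (λ i j eq → Fin.suc-injective (injective _ _ eq)) isRoot′))
    where
    a = root zero
    isRoot′ : ∀ i → monic (quotient (c ∷ cs) a) (root (suc i)) ≈ 0#
    isRoot′ i = [ ⊥-elim ∘ root-a≉0 , id ]′ (x*y≈0⇒x≈0⊎y≈0 (begin
      (root (suc i) - a) * monic (quotient (c ∷ cs) a) (root (suc i))                 ≈⟨ +-identityʳ _ ⟨
      (root (suc i) - a) * monic (quotient (c ∷ cs) a) (root (suc i)) + 0#            ≈⟨ +-congˡ (isRoot zero) ⟨
      (root (suc i) - a) * monic (quotient (c ∷ cs) a) (root (suc i)) + monic (c ∷ cs) a ≈⟨ division c cs a (root (suc i)) ⟨
      monic (c ∷ cs) (root (suc i))                                                   ≈⟨ isRoot (suc i) ⟩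
      0#                                                                              ∎))
      where
      root-a≉0 : ¬ root (suc i) - a ≈ 0#
      root-a≉0 = Fin.0≢1+n ∘ ≡.sym ∘ injective (suc i) zero ∘ x-y≈0⇒x≈y

  x^n+cx-monic : ∀ {n} → 2 ≤ n → ∀ c → ∃ λ cs → length cs ≡ n × (∀ x → monic cs x ≈ x ^ n + c * x)
  x^n+cx-monic {suc (suc t)} (s≤s (s≤s _)) c =
    0# ∷ c ∷ replicate t 0# , cong (λ n → suc (suc n)) (length-replicate t {0#}) , λ x → begin
      0# + x * (c + x * monic (replicate t 0#) x)  ≈⟨ +-congˡ (*-congˡ (+-congˡ (*-congˡ (monic-zeros t x)))) ⟩
      0# + x * (c + x * x ^ t)                     ≈⟨ solve 3 (λ x c u → con (+ 0) :+ x :* (c :+ x :* u) := x :* (x :* u) :+ c :* x)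
                                                              refl x c (x ^ t) ⟩
      x * (x * x ^ t) + c * x                      ∎
    where
    monic-zeros : ∀ t x → monic (replicate t 0#) x ≈ x ^ t
    monic-zeros zero    x = refl
    monic-zeros (suc t) x = trans (+-identityˡ _) (*-congˡ (monic-zeros t x))

  roots-x^n+cx≤n : ∀ {n p} {P : Pred Carrier p} → 2 ≤ n → ∀ c → (E : Enumeration setoid P) →
                   (∀ {x} → P x → x ^ n + c * x ≈ 0#) → card E ≤ n
  roots-x^n+cx≤n 2≤n c E isRoot with x^n+cx-monic 2≤n c
  ... | cs , length≡n , monic≈ = ≡.subst (card E ≤_) length≡n
    (roots≤degree cs (elem E) (elem-injective E) (λ i → trans (monic≈ (elem E i)) (isRoot (elem∈ E i))))

module LinearizedPolynomial {c ℓ} (F : FiniteField c ℓ) {p k : ℕ} (p-prime : Prime p) (1≤k : 1 ≤ k)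
                            (size≡q*q : FiniteField.size F ≡ p ℕ.^ k ℕ.* p ℕ.^ k)
                            (bs : List (FiniteField.Carrier F)) where
  open FiniteField F hiding (zero)
  open FiniteFieldTheory F
  open CharacteristicRing commRing using (frobenius-^)
  open AdditiveSubgroup
  open CommutativeSemiringExp commutativeSemiring using (_^_; ^-congˡ; ^-homo-*; ^-assocʳ)
  open RingProperties ring using (-1*x≈-x)
  open SemiringMult semiring using () renaming (_×_ to _·_)
  open IntegerCoefficientSolver commRing using (solve; _:=_; _:+_; _:*_; _:-_; con)
  open import Relation.Binary.Reasoning.Setoid setoid

  q : ℕ
  q = p ℕ.^ k

  2≤q : 2 ≤ q
  2≤q = 2≤p^k p-prime 1≤k

  instance
    q-nonZero : NonZero q
    q-nonZero = ℕ.>-nonZero (ℕ.≤-trans (s≤s z≤n) 2≤q)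

  char-p : p · 1# ≈ 0#
  char-p = characteristic {p} {k} size≡q*q

  frobenius-q : ∀ x y → (x + y) ^ q ≈ x ^ q + y ^ q
  frobenius-q = frobenius-^ p-prime char-p k

  pow-frobenius : ∀ i x y → pow F (x + y) (p ℕ.^ i) ≈ pow F x (p ℕ.^ i) + pow F y (p ℕ.^ i)
  pow-frobenius i x y rewrite pow≡^ (x + y) (p ℕ.^ i) | pow≡^ x (p ℕ.^ i) | pow≡^ y (p ℕ.^ i) =
    frobenius-^ p-prime char-p i x y

  module Frobenius = AdditiveMap (_^ q) (^-congˡ q) frobenius-q

  L : Carrier → Carrier
  L = linPoly F p bs

  linPolyFrom-cong : ∀ i cs {x y} → x ≈ y → linPolyFrom F p i cs x ≈ linPolyFrom F p i cs y
  linPolyFrom-cong i []       x≈y = refl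
  linPolyFrom-cong i (c ∷ cs) x≈y = +-cong (*-congˡ (pow-cong (p ℕ.^ i) x≈y)) (linPolyFrom-cong (suc i) cs x≈y)

  linPolyFrom-+ : ∀ i cs x y → linPolyFrom F p i cs (x + y) ≈ linPolyFrom F p i cs x + linPolyFrom F p i cs y
  linPolyFrom-+ i []       x y = sym (+-identityˡ 0#)
  linPolyFrom-+ i (c ∷ cs) x y = begin
    c * pow F (x + y) (p ℕ.^ i) + linPolyFrom F p (suc i) cs (x + y)
      ≈⟨ +-cong (*-congˡ (pow-frobenius i x y)) (linPolyFrom-+ (suc i) cs x y) ⟩
    c * (u + v) + (A + B)
      ≈⟨ solve 5 (λ c u v A B → c :* (u :+ v) :+ (A :+ B) := (c :* u :+ A) :+ (c :* v :+ B)) refl c u v A B ⟩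
    (c * u + A) + (c * v + B) ∎
    where
    u = pow F x (p ℕ.^ i)
    v = pow F y (p ℕ.^ i)
    A = linPolyFrom F p (suc i) cs x
    B = linPolyFrom F p (suc i) cs y

  L-cong : ∀ {x y} → x ≈ y → L x ≈ L y
  L-cong = linPolyFrom-cong 0 bs

  L-+ : ∀ x y → L (x + y) ≈ L x + L y
  L-+ = linPolyFrom-+ 0 bs

  module ℒ = AdditiveMap L L-cong L-+

  -- The kernel of φ is the subfield 𝔽_q.
  φ : Carrier → Carrier
  φ x = x ^ q - x

  φ-cong : ∀ {x y} → x ≈ y → φ x ≈ φ y
  φ-cong x≈y = +-cong (^-congˡ q x≈y) (-‿cong x≈y)

  φ-+ : ∀ x y → φ (x + y) ≈ φ x + φ y
  φ-+ x y = trans (+-congʳ (frobenius-q x y))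
    (solve 4 (λ a b x y → (a :+ b) :- (x :+ y) := (a :- x) :+ (b :- y)) refl (x ^ q) (y ^ q) x y)

  module Φ = AdditiveMap φ φ-cong φ-+

  ψ : Carrier → Carrier
  ψ x = x ^ q + x

  ψ-cong : ∀ {x y} → x ≈ y → ψ x ≈ ψ y
  ψ-cong x≈y = +-cong (^-congˡ q x≈y) x≈y

  ψ-+ : ∀ x y → ψ (x + y) ≈ ψ x + ψ y
  ψ-+ x y = trans (+-congʳ (frobenius-q x y))
    (solve 4 (λ a b x y → (a :+ b) :+ (x :+ y) := (a :+ x) :+ (b :+ y)) refl (x ^ q) (y ^ q) x y)

  module Ψ = AdditiveMap ψ ψ-cong ψ-+

  order-kerΦ≤q : order Φ.kernel ≤ q
  order-kerΦ≤q = roots-x^n+cx≤n 2≤q (- 1#) (members Φ.kernel) (λ {x} φx≈0 → trans (+-congˡ (-1*x≈-x x)) φx≈0)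

  order-kerΨ≤q : order Ψ.kernel ≤ q
  order-kerΨ≤q = roots-x^n+cx≤n 2≤q 1# (members Ψ.kernel) (λ {x} ψx≈0 → trans (+-congˡ (*-identityˡ x)) ψx≈0)

  ψ∘φ≈0 : ∀ z → ψ (φ z) ≈ 0#
  ψ∘φ≈0 z = begin
    (z ^ q - z) ^ q + (z ^ q - z)        ≈⟨ +-congʳ (Frobenius.g-sub (z ^ q) z) ⟩
    ((z ^ q) ^ q - z ^ q) + (z ^ q - z)  ≈⟨ +-congʳ (+-congʳ z^q^q≈z) ⟩
    (z - z ^ q) + (z ^ q - z)            ≈⟨ solve 2 (λ z a → (z :- a) :+ (a :- z) := con (+ 0)) refl z (z ^ q) ⟩
    0#                                   ∎
    where
    z^q^q≈z : (z ^ q) ^ q ≈ z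
    z^q^q≈z = trans (^-assocʳ z q q) (trans (reflexive (cong (z ^_) (≡.sym size≡q*q))) (x^size≈x z))

  imageΦ⊆kernelΨ : ∀ {y} → Member Φ.image y → Member Ψ.kernel y
  imageΦ⊆kernelΨ (i , φi≈y) = trans (ψ-cong (sym φi≈y)) (ψ∘φ≈0 (enum i))

  q*q≤order-kerΦ*order-kerΨ : q ℕ.* q ≤ order Φ.kernel ℕ.* order Ψ.kernel
  q*q≤order-kerΦ*order-kerΨ = ≡.subst (ℕ._≤ order Φ.kernel ℕ.* order Ψ.kernel) size≡q*q
    (ℕ.≤-trans Φ.size≤order-kernel*order-image (ℕ.*-monoʳ-≤ (order Φ.kernel) (order-mono Φ.image Ψ.kernel imageΦ⊆kernelΨ)))

  q≤order-kerΦ : q ≤ order Φ.kernel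
  q≤order-kerΦ = o*o≤m*n⇒n≤o⇒o≤m q*q≤order-kerΦ*order-kerΨ order-kerΨ≤q

  q≤order-kerΨ : q ≤ order Ψ.kernel
  q≤order-kerΨ = o*o≤m*n⇒n≤o⇒o≤m (≡.subst (q ℕ.* q ≤_) (ℕ.*-comm (order Φ.kernel) _) q*q≤order-kerΦ*order-kerΨ) order-kerΦ≤q

  f : Carrier → Carrier
  f x = pow F x (q ℕ.+ 1) + L (pow F x 2)

  f≈ : ∀ x → f x ≈ x ^ q * x + L (x * x)
  f≈ x = +-cong (trans (reflexive (pow≡^ x (q ℕ.+ 1))) (trans (^-homo-* x q 1) (*-congˡ (*-identityʳ x))))
                (L-cong (*-congˡ (*-identityʳ x)))

  f-difference : ∀ x → f (x + 1#) - f x ≈ (ψ x + L (x + x)) + (1# + L 1#)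
  f-difference x = begin
    f (x + 1#) - f x
      ≈⟨ +-cong (f≈ (x + 1#)) (-‿cong (f≈ x)) ⟩
    ((x + 1#) ^ q * (x + 1#) + L ((x + 1#) * (x + 1#))) - (x ^ q * x + L (x * x))
      ≈⟨ +-congʳ (+-cong (*-congʳ (trans (frobenius-q x 1#) (+-congˡ (1^n≈1 q)))) (L-cong square)) ⟩
    ((x ^ q + 1#) * (x + 1#) + L ((x * x + (x + x)) + 1#)) - (x ^ q * x + L (x * x))
      ≈⟨ +-congʳ (+-congˡ (trans (L-+ _ 1#) (+-congʳ (L-+ (x * x) (x + x))))) ⟩
    ((x ^ q + 1#) * (x + 1#) + ((L (x * x) + L (x + x)) + L 1#)) - (x ^ q * x + L (x * x))
      ≈⟨ solve 5 (λ X x A B C → ((X :+ con (+ 1)) :* (x :+ con (+ 1)) :+ ((A :+ B) :+ C)) :- (X :* x :+ A)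
                                := ((X :+ x) :+ B) :+ (con (+ 1) :+ C)) refl (x ^ q) x (L (x * x)) (L (x + x)) (L 1#) ⟩
    (ψ x + L (x + x)) + (1# + L 1#) ∎
    where
    square : (x + 1#) * (x + 1#) ≈ (x * x + (x + x)) + 1#
    square = solve 1 (λ x → (x :+ con (+ 1)) :* (x :+ con (+ 1)) := (x :* x :+ (x :+ x)) :+ con (+ 1)) refl x

  kernelℒ∩kernelΨ≈0 : Planar F f → ∀ {w} → Member ℒ.kernel w → Member Ψ.kernel w → w ≈ 0#
  kernelℒ∩kernelΨ≈0 planar {w} Lw≈0 ψw≈0 = proj₁ (planar 1# 1≉0) w 0# (begin
    f (w + 1#) - f w                   ≈⟨ f-difference w ⟩
    (ψ w + L (w + w)) + (1# + L 1#)    ≈⟨ +-congʳ (+-cong ψw≈0 L[w+w]≈0) ⟩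
    (0# + 0#) + (1# + L 1#)            ≈⟨ +-congʳ (+-cong Ψ.g-0 (trans (L-cong (+-identityˡ 0#)) ℒ.g-0)) ⟨
    (ψ 0# + L (0# + 0#)) + (1# + L 1#) ≈⟨ f-difference 0# ⟨
    f (0# + 1#) - f 0#                 ∎)
    where
    L[w+w]≈0 : L (w + w) ≈ 0#
    L[w+w]≈0 = trans (L-+ w w) (trans (+-cong Lw≈0 Lw≈0) (+-identityˡ 0#))

  numRoots≤q : Planar F f → numRoots F L ≤ q
  numRoots≤q planar = m*n≤o*o⇒o≤n⇒m≤o
    (≡.subst (order ℒ.kernel ℕ.* order Ψ.kernel ≤_) size≡q*q (order*order≤size ℒ.kernel Ψ.kernel (kernelℒ∩kernelΨ≈0 planar)))
    q≤order-kerΨ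

  numRoots≡q : Planar F f → ImageMeetsSubfieldTrivially F q L → numRoots F L ≡ q
  numRoots≡q planar image∩𝔽q≈0 = ℕ.≤-antisym (numRoots≤q planar) (o*o≤m*n⇒n≤o⇒o≤m
    (≡.subst (ℕ._≤ order ℒ.kernel ℕ.* order ℒ.image) size≡q*q ℒ.size≤order-kernel*order-image)
    order-imℒ≤q)
    where
    imageℒ∩kernelΦ≈0 : ∀ {y} → Member ℒ.image y → Member Φ.kernel y → y ≈ 0#
    imageℒ∩kernelΦ≈0 (i , Li≈y) φy≈0 = trans (sym Li≈y)
      (image∩𝔽q≈0 (enum i) (trans (reflexive (pow≡^ _ q)) (trans (^-congˡ q Li≈y) (trans (x-y≈0⇒x≈y φy≈0) (sym Li≈y)))))
    order-imℒ≤q : order ℒ.image ≤ q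
    order-imℒ≤q = m*n≤o*o⇒o≤n⇒m≤o
      (≡.subst (order ℒ.image ℕ.* order Φ.kernel ≤_) size≡q*q (order*order≤size ℒ.image Φ.kernel imageℒ∩kernelΦ≈0))
      q≤order-kerΦ

open import Data.Nat using (_^_; _+_; _*_)

-- The argument never uses that p is odd.
mainTheorem3 : {c ℓ : Level} (p k : ℕ) → Prime p → p ≢ 2 → 1 ≤ k →
    (F : FiniteField c ℓ) → FiniteField.size F ≡ (p ^ k) * (p ^ k) →
    (bs : List (FiniteField.Carrier F)) →
    Planar F (λ x → FiniteField._+_ F (pow F x (p ^ k + 1)) (linPoly F p bs (pow F x 2))) →
    (numRoots F (linPoly F p bs) ≤ p ^ k)
    × (ImageMeetsSubfieldTrivially F (p ^ k) (linPoly F p bs) → numRoots F (linPoly F p bs) ≡ p ^ k)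
mainTheorem3 p k p-prime _ 1≤k F size≡q*q bs planar = numRoots≤q planar , numRoots≡q planar
  where open LinearizedPolynomial F p-prime 1≤k size≡q*q bs
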